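{- For every graph $G$, $\mathrm{thin}_{ind,prec}(G)=\mathrm{thin}_{cmp,prec}(\overline{G})$ and $\mathrm{pthin}_{ind,prec}(G)=\mathrm{pthin}_{cmp,prec}(\overline{G})$.
   Context: $\overline{G}$ is the complement of $G$. An ordering $<$ of $V(G)$ is consistent with a partition $\mathcal{V}$ if for every $p<q<r$ with $p,q$ in the same class and $pr\in E(G)$, also $qr\in E(G)$; strongly consistent if both $<$ and its reversal are consistent. $\mathrm{thin}_{ind,prec}(G)$ (resp. $\mathrm{pthin}_{ind,prec}(G)$) is the minimum $k$ such that $V(G)$ has a partition into $k$ independent sets and an ordering consistent (resp. strongly consistent) with it in which each class is consecutive; $\mathrm{thin}_{cmp,prec}$ and $\mathrm{pthin}_{cmp,prec}$ are defined likewise with cliques instead of independent sets. -}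

module Defs where

open import Data.Nat using (ℕ; _≤_)
open import Data.Fin using (Fin; _<_)
open import Data.Bool using (Bool; true; false; not)
open import Data.Product using (Σ; _×_; _,_)
open import Relation.Binary.PropositionalEquality using (_≡_; _≢_)
open import Relation.Nullary using (¬_; yes; no)
open import Function.Bundles using (_↔_; Inverse)
import Data.Fin as F

record Graph (n : ℕ) : Set where
  field
    adj   : Fin n → Fin n → Bool
    sym   : ∀ u v → adj u v ≡ adj v u
    irref : ∀ v → adj v v ≡ false

open Graph public

E : ∀ {n} → Graph n → Fin n → Fin n → Set
E G u v = adj G u v ≡ true

complAdj : ∀ {n} → Graph n → Fin n → Fin n → Bool
complAdj G u v with u F.≟ v
... | yes _ = false
... | no  _ = not (adj G u v)

complement : ∀ {n} → Graph n → Graph n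
complement {n} G = record { adj = complAdj G ; sym = s ; irref = i }
  where
  open import Relation.Binary.PropositionalEquality using (refl; cong)
  s : ∀ u v → complAdj G u v ≡ complAdj G v u
  s u v with u F.≟ v | v F.≟ u
  ... | yes _ | yes _ = refl
  ... | yes refl | no q = Data.Empty.⊥-elim (q refl) where import Data.Empty
  ... | no p | yes refl = Data.Empty.⊥-elim (p refl) where import Data.Empty
  ... | no _ | no _ = cong not (sym G u v)
  i : ∀ v → complAdj G v v ≡ false
  i v with v F.≟ v
  ... | yes _ = refl
  ... | no p = Data.Empty.⊥-elim (p refl) where import Data.Empty

-- A partition of V(G) into k classes is given by a class map c : Fin n → Fin k
-- (vertices u, v in the same class iff c u ≡ c v).
-- A linear ordering of V(G) is given by a bijection pos : Fin n ↔ Fin n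
-- assigning to each vertex its position; u precedes v iff pos u < pos v.
Before : ∀ {n} → (Fin n ↔ Fin n) → Fin n → Fin n → Set
Before pos u v = Inverse.to pos u < Inverse.to pos v

Consistent : ∀ {n k} → Graph n → (Fin n → Fin k) → (Fin n ↔ Fin n) → Set
Consistent G c pos = ∀ p q r → Before pos p q → Before pos q r →
  c p ≡ c q → E G p r → E G q r

ReverseConsistent : ∀ {n k} → Graph n → (Fin n → Fin k) → (Fin n ↔ Fin n) → Set
ReverseConsistent G c pos = ∀ p q r → Before pos q p → Before pos r q →
  c p ≡ c q → E G p r → E G q r

StronglyConsistent : ∀ {n k} → Graph n → (Fin n → Fin k) → (Fin n ↔ Fin n) → Set
StronglyConsistent G c pos = Consistent G c pos × ReverseConsistent G c pos

ClassesConsecutive : ∀ {n k} → (Fin n → Fin k) → (Fin n ↔ Fin n) → Set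
ClassesConsecutive c pos = ∀ p q r → Before pos p q → Before pos q r →
  c p ≡ c r → c q ≡ c p

ClassesIndependent : ∀ {n k} → Graph n → (Fin n → Fin k) → Set
ClassesIndependent G c = ∀ u v → c u ≡ c v → ¬ E G u v

ClassesCliques : ∀ {n k} → Graph n → (Fin n → Fin k) → Set
ClassesCliques G c = ∀ u v → u ≢ v → c u ≡ c v → E G u v

IndPrec : ∀ {n} → Graph n → ℕ → Set
IndPrec {n} G k = Σ (Fin n → Fin k) λ c → Σ (Fin n ↔ Fin n) λ pos →
  ClassesIndependent G c × Consistent G c pos × ClassesConsecutive c pos

PIndPrec : ∀ {n} → Graph n → ℕ → Set
PIndPrec {n} G k = Σ (Fin n → Fin k) λ c → Σ (Fin n ↔ Fin n) λ pos →
  ClassesIndependent G c × StronglyConsistent G c pos × ClassesConsecutive c pos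

CmpPrec : ∀ {n} → Graph n → ℕ → Set
CmpPrec {n} G k = Σ (Fin n → Fin k) λ c → Σ (Fin n ↔ Fin n) λ pos →
  ClassesCliques G c × Consistent G c pos × ClassesConsecutive c pos

PCmpPrec : ∀ {n} → Graph n → ℕ → Set
PCmpPrec {n} G k = Σ (Fin n → Fin k) λ c → Σ (Fin n ↔ Fin n) λ pos →
  ClassesCliques G c × StronglyConsistent G c pos × ClassesConsecutive c pos

IsMin : (ℕ → Set) → ℕ → Set
IsMin P k = P k × (∀ m → P m → k ≤ m)

ThinIndPrec : ∀ {n} → Graph n → ℕ → Set
ThinIndPrec G = IsMin (IndPrec G)

PThinIndPrec : ∀ {n} → Graph n → ℕ → Set
PThinIndPrec G = IsMin (PIndPrec G)

ThinCmpPrec : ∀ {n} → Graph n → ℕ → Set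
ThinCmpPrec G = IsMin (CmpPrec G)

PThinCmpPrec : ∀ {n} → Graph n → ℕ → Set
PThinCmpPrec G = IsMin (PCmpPrec G)

{-# OPTIONS --safe #-}
-- Keep the partition (independent sets of G are the cliques of its
-- complement) and reverse the order inside every class, leaving the order of
-- the consecutive classes unchanged. If p, q precede r in the new order with
-- p, q in one class and r in another, then q precedes p precedes r in the old
-- one, so consistency of the old order for G turns an edge qr of G into an
-- edge pr of G; this is exactly consistency of the new order for the
-- complement. The same reversal works from the complement back to G, so both
-- sides admit the same k and have the same minimum.
module Submission where

open import Defs
open import Data.Nat using (ℕ)
open import Data.Product using (_×_)
open import Function.Bundles using (_⇔_)

open import Data.Bool using (true; false)
open import Data.Empty using (⊥; ⊥-elim)
open import Data.Fin using (Fin; fromℕ<; punchOut)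
open import Data.Fin.Properties as Fin
  using (any?; injective⇒≤; punchOut-injective; fromℕ<-injective; toℕ-fromℕ<)
open import Data.Fin.Subset using (Subset; _∈_; ∣_∣)
open import Data.Fin.Subset.Properties using (∈⊤; ⊆⊤; ∣⊤∣≡n; p⊂q⇒∣p∣<∣q∣)
import Data.Nat as ℕ
import Data.Nat.Properties as ℕ
open import Data.Product using (_,_; proj₁; proj₂)
open import Data.Sum using (_⊎_; inj₁; inj₂; [_,_]′)
open import Data.Vec using (tabulate)
open import Data.Vec.Properties using (lookup∘tabulate; lookup⇒[]=; []=⇒lookup)
open import Function using (id; flip; _∘_)
open import Function.Bundles using (_↔_; Inverse; Injection; mk⇔; mk⤖)
open import Function.Consequences.Propositional using (strictlySurjective⇒surjective)
open import Function.Definitions using (Injective; StrictlySurjective)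
open import Function.Properties.Bijection using (⤖⇒↔)
open import Function.Properties.Inverse using (↔⇒↣)
open import Level using (0ℓ)
open import Relation.Binary using (Rel; Decidable; Transitive; Irreflexive; tri<; tri≈; tri>)
open import Relation.Binary.PropositionalEquality
  using (_≡_; _≢_; refl; trans; cong; subst₂)
import Relation.Binary.PropositionalEquality as ≡
open import Relation.Nullary using (¬_; yes; no; does; contradiction)
open import Relation.Nullary.Decidable using (dec-true; _×-dec_; _⊎-dec_; ¬?)

injective⇒strictlySurjective : ∀ {n} {f : Fin n → Fin n} →
  Injective _≡_ _≡_ f → StrictlySurjective _≡_ f
injective⇒strictlySurjective {ℕ.suc m} {f} f-inj y with any? (λ x → f x Fin.≟ y)
... | yes hit = hit
... | no miss = contradiction (injective⇒≤ punchOut∘f-injective) ℕ.1+n≰n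
  where
  y≢f : ∀ x → y ≢ f x
  y≢f x y≡fx = miss (x , ≡.sym y≡fx)

  punchOut∘f-injective : Injective _≡_ _≡_ (λ x → punchOut (y≢f x))
  punchOut∘f-injective = f-inj ∘ punchOut-injective (y≢f _) (y≢f _)

-- A linear order of Fin n, given as a strict total order, is realised by the
-- permutation sending each element to its number of predecessors.
module Ranking {n} {_≺_ : Rel (Fin n) 0ℓ} (_≺?_ : Decidable _≺_)
  (≺-trans : Transitive _≺_) (≺-irrefl : Irreflexive _≡_ _≺_)
  (≺-connex : ∀ {u v} → u ≢ v → u ≺ v ⊎ v ≺ u) where

  predecessors : Fin n → Subset n
  predecessors v = tabulate (λ u → does (u ≺? v))

  ∈-predecessors⁺ : ∀ {u v} → u ≺ v → u ∈ predecessors v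
  ∈-predecessors⁺ {u} {v} u≺v =
    lookup⇒[]= u _ (trans (lookup∘tabulate _ u) (dec-true (u ≺? v) u≺v))

  ∈-predecessors⁻ : ∀ {u v} → u ∈ predecessors v → u ≺ v
  ∈-predecessors⁻ {u} {v} u∈
    with u ≺? v | trans (≡.sym (lookup∘tabulate (λ w → does (w ≺? v)) u)) ([]=⇒lookup u∈)
  ... | yes u≺v | _ = u≺v
  ... | no _    | ()

  ∉-predecessors : ∀ v → ¬ v ∈ predecessors v
  ∉-predecessors v = ≺-irrefl refl ∘ ∈-predecessors⁻

  rank : Fin n → ℕ
  rank v = ∣ predecessors v ∣

  rank<n : ∀ v → rank v ℕ.< n
  rank<n v = subst₂ ℕ._<_ refl (∣⊤∣≡n n)
    (p⊂q⇒∣p∣<∣q∣ (⊆⊤ , v , ∈⊤ , ∉-predecessors v))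

  rank-mono : ∀ {u v} → u ≺ v → rank u ℕ.< rank v
  rank-mono {u} u≺v = p⊂q⇒∣p∣<∣q∣
    ( (λ w∈ → ∈-predecessors⁺ (≺-trans (∈-predecessors⁻ w∈) u≺v))
    , u , ∈-predecessors⁺ u≺v , ∉-predecessors u)

  rank-injective : ∀ {u v} → rank u ≡ rank v → u ≡ v
  rank-injective {u} {v} eq with u Fin.≟ v
  ... | yes u≡v = u≡v
  ... | no u≢v = contradiction eq
    ([ ℕ.<⇒≢ ∘ rank-mono , ℕ.>⇒≢ ∘ rank-mono ]′ (≺-connex u≢v))

  rank-reflects : ∀ {u v} → rank u ℕ.< rank v → u ≺ v
  rank-reflects {u} {v} r<r with u Fin.≟ v
  ... | yes refl = ⊥-elim (ℕ.<-irrefl refl r<r)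
  ... | no u≢v = [ id , (λ v≺u → contradiction (rank-mono v≺u) (ℕ.<⇒≯ r<r)) ]′
    (≺-connex u≢v)

  position : Fin n → Fin n
  position v = fromℕ< (rank<n v)

  position-injective : Injective _≡_ _≡_ position
  position-injective = rank-injective ∘ fromℕ<-injective _ _ (rank<n _) (rank<n _)

  ranking : Fin n ↔ Fin n
  ranking = ⤖⇒↔ (mk⤖ ( position-injective
                     , strictlySurjective⇒surjective
                         (injective⇒strictlySurjective position-injective)))

  Before-ranking⇒≺ : ∀ {u v} → Before ranking u v → u ≺ v
  Before-ranking⇒≺ {u} {v} =
    rank-reflects ∘ subst₂ ℕ._<_ (toℕ-fromℕ< (rank<n u)) (toℕ-fromℕ< (rank<n v))

module _ {n : ℕ} where

  Before-connex : (pos : Fin n ↔ Fin n) → ∀ {u v} → u ≢ v →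
    Before pos u v ⊎ Before pos v u
  Before-connex pos {u} {v} u≢v with Fin.<-cmp (Inverse.to pos u) (Inverse.to pos v)
  ... | tri< lt _ _ = inj₁ lt
  ... | tri≈ _ eq _ = contradiction (Injection.injective (↔⇒↣ pos) eq) u≢v
  ... | tri> _ _ gt = inj₂ gt

  Before-irrefl : (pos : Fin n ↔ Fin n) → Irreflexive _≡_ (Before pos)
  Before-irrefl pos refl = Fin.<-irrefl refl

  Before-trans : (pos : Fin n ↔ Fin n) → Transitive (Before pos)
  Before-trans pos = Fin.<-trans

  -- Consistent G c pos and ReverseConsistent G c pos are, definitionally,
  -- ConsistentWith G c (Before pos) and ConsistentWith G c (flip (Before pos)).
  ConsistentWith : ∀ {k} → Graph n → (Fin n → Fin k) → Rel (Fin n) 0ℓ → Set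
  ConsistentWith G c _≺_ = ∀ p q r → p ≺ q → q ≺ r → c p ≡ c q → E G p r → E G q r

  ReversedWithinClasses : ∀ {k} → (Fin n → Fin k) → Rel (Fin n) 0ℓ → Rel (Fin n) 0ℓ → Set
  ReversedWithinClasses c _≺_ _≺′_ = ∀ {p q} → p ≺′ q →
    (c p ≡ c q → q ≺ p) × (c p ≢ c q → p ≺ q)

  ReversedWithinClasses-flip : ∀ {k} {c : Fin n → Fin k} {_≺_ _≺′_ : Rel (Fin n) 0ℓ} →
    ReversedWithinClasses c _≺_ _≺′_ → ReversedWithinClasses c (flip _≺_) (flip _≺′_)
  ReversedWithinClasses-flip rev q≺′p =
    proj₁ (rev q≺′p) ∘ ≡.sym , (λ cp≢cq → proj₂ (rev q≺′p) (cp≢cq ∘ ≡.sym))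

  ClassesHomogeneous : ∀ {k} → Graph n → (Fin n → Fin k) → Set
  ClassesHomogeneous G c = ∀ p q r → c p ≡ c q → c q ≡ c r → q ≢ r → E G p r → E G q r

  independent⇒homogeneous : ∀ {k} {G : Graph n} {c : Fin n → Fin k} →
    ClassesIndependent G c → ClassesHomogeneous G c
  independent⇒homogeneous ind p q r cp≡cq cq≡cr _ pr = ⊥-elim (ind p r (trans cp≡cq cq≡cr) pr)

  cliques⇒homogeneous : ∀ {k} {G : Graph n} {c : Fin n → Fin k} →
    ClassesCliques G c → ClassesHomogeneous G c
  cliques⇒homogeneous cl p q r _ cq≡cr q≢r _ = cl q r q≢r cq≡cr

record Complementary {n} (G H : Graph n) : Set where
  field
    cover    : ∀ u v → u ≢ v → E G u v ⊎ E H u v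
    disjoint : ∀ u v → E G u v → E H u v → ⊥

module _ {n} (G : Graph n) where

  complement-complementary : Complementary G (complement G)
  complement-complementary = record { cover = cover ; disjoint = disjoint }
    where
    cover : ∀ u v → u ≢ v → E G u v ⊎ E (complement G) u v
    cover u v u≢v with u Fin.≟ v
    ... | yes u≡v = contradiction u≡v u≢v
    ... | no _ with adj G u v
    ...   | true  = inj₁ refl
    ...   | false = inj₂ refl

    disjoint : ∀ u v → E G u v → E (complement G) u v → ⊥
    disjoint u v uv uv̅ with u Fin.≟ v
    disjoint u v uv () | yes _
    ... | no _ with adj G u v
    disjoint u v uv () | no _ | true
    disjoint u v () uv̅ | no _ | false

module _ {n} {G H : Graph n} (GH : Complementary G H) where
  open Complementary GH

  Complementary-sym : Complementary H G
  Complementary-sym = record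
    { cover    = λ u v u≢v → [ inj₂ , inj₁ ]′ (cover u v u≢v)
    ; disjoint = λ u v uv-H uv-G → disjoint u v uv-G uv-H }

  independent⇒cliques : ∀ {k} {c : Fin n → Fin k} →
    ClassesIndependent G c → ClassesCliques H c
  independent⇒cliques ind u v u≢v cu≡cv =
    [ (λ uv → ⊥-elim (ind u v cu≡cv uv)) , id ]′ (cover u v u≢v)

  cliques⇒independent : ∀ {k} {c : Fin n → Fin k} →
    ClassesCliques H c → ClassesIndependent G c
  cliques⇒independent cl u v cu≡cv uv with u Fin.≟ v
  ... | yes refl = contradiction (trans (≡.sym (irref G u)) uv) λ ()
  ... | no u≢v = disjoint u v uv (cl u v u≢v cu≡cv)

  -- If q ≺′ r and qr is not an edge of H, then qr is an edge of G, and the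
  -- old order q ≺ p ≺ r carries it to the edge pr of G, which H excludes.
  ConsistentWith-transfer : ∀ {k} {c : Fin n → Fin k} {_≺_ _≺′_ : Rel (Fin n) 0ℓ} →
    ClassesHomogeneous H c → Transitive _≺′_ → Irreflexive _≡_ _≺′_ →
    ReversedWithinClasses c _≺_ _≺′_ → ConsistentWith G c _≺_ → ConsistentWith H c _≺′_
  ConsistentWith-transfer {c = c} hom ≺′-trans ≺′-irrefl rev consistent
    p q r p≺′q q≺′r cp≡cq pr with c q Fin.≟ c r
  ... | yes cq≡cr = hom p q r cp≡cq cq≡cr q≢r pr
    where q≢r = λ q≡r → ≺′-irrefl q≡r q≺′r
  ... | no cq≢cr = [ carry , id ]′ (cover q r λ q≡r → ≺′-irrefl q≡r q≺′r)
    where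
    carry : E G q r → E H q r
    carry qr = ⊥-elim (disjoint p r
      (consistent q p r (proj₁ (rev p≺′q) cp≡cq)
        (proj₂ (rev (≺′-trans p≺′q q≺′r)) (cq≢cr ∘ trans (≡.sym cp≡cq)))
        (≡.sym cp≡cq) qr)
      pr)

module BlockReversal {n k} (c : Fin n → Fin k) (pos : Fin n ↔ Fin n)
  (consecutive : ClassesConsecutive c pos) where

  _≺_ : Rel (Fin n) 0ℓ
  u ≺ v = (c u ≡ c v × Before pos v u) ⊎ (c u ≢ c v × Before pos u v)

  _≺?_ : Decidable _≺_
  u ≺? v = (c u Fin.≟ c v ×-dec Inverse.to pos v Fin.<? Inverse.to pos u)
      ⊎-dec (¬? (c u Fin.≟ c v) ×-dec Inverse.to pos u Fin.<? Inverse.to pos v)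

  ≺-irrefl : Irreflexive _≡_ _≺_
  ≺-irrefl refl (inj₁ (_ , lt)) = Before-irrefl pos refl lt
  ≺-irrefl refl (inj₂ (cu≢cu , _)) = cu≢cu refl

  -- A vertex of another class lying between two vertices of one class would
  -- contradict consecutiveness.
  ≺-trans : Transitive _≺_
  ≺-trans (inj₁ (cu≡cv , v<u)) (inj₁ (cv≡cw , w<v)) =
    inj₁ (trans cu≡cv cv≡cw , Before-trans pos w<v v<u)
  ≺-trans {u} {v} {w} (inj₂ (cu≢cv , u<v)) (inj₂ (cv≢cw , v<w)) =
    inj₂ ( (λ cu≡cw → cu≢cv (≡.sym (consecutive u v w u<v v<w cu≡cw)))
         , Before-trans pos u<v v<w)
  ≺-trans {u} {v} {w} (inj₂ (cu≢cv , u<v)) (inj₁ (cv≡cw , w<v)) =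
    inj₂ (cu≢cw , [ id , w≮u ]′ (Before-connex pos (cu≢cw ∘ cong c)))
    where
    cu≢cw = λ cu≡cw → cu≢cv (trans cu≡cw (≡.sym cv≡cw))
    w≮u = λ w<u → ⊥-elim (cu≢cw (consecutive w u v w<u u<v (≡.sym cv≡cw)))
  ≺-trans {u} {v} {w} (inj₁ (cu≡cv , v<u)) (inj₂ (cv≢cw , v<w)) =
    inj₂ (cu≢cw , [ id , w≮u ]′ (Before-connex pos (cu≢cw ∘ cong c)))
    where
    cu≢cw = λ cu≡cw → cv≢cw (trans (≡.sym cu≡cv) cu≡cw)
    w≮u = λ w<u → ⊥-elim (cv≢cw (≡.sym (consecutive v w u v<w w<u (≡.sym cu≡cv))))

  ≺-connex : ∀ {u v} → u ≢ v → u ≺ v ⊎ v ≺ u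
  ≺-connex {u} {v} u≢v with c u Fin.≟ c v | Before-connex pos u≢v
  ... | yes cu≡cv | inj₁ u<v = inj₂ (inj₁ (≡.sym cu≡cv , u<v))
  ... | yes cu≡cv | inj₂ v<u = inj₁ (inj₁ (cu≡cv , v<u))
  ... | no cu≢cv  | inj₁ u<v = inj₁ (inj₂ (cu≢cv , u<v))
  ... | no cu≢cv  | inj₂ v<u = inj₂ (inj₂ (cu≢cv ∘ ≡.sym , v<u))

  open Ranking _≺?_ ≺-trans ≺-irrefl ≺-connex using (ranking; Before-ranking⇒≺)

  reversed : Fin n ↔ Fin n
  reversed = ranking

  reversed-reversedWithinClasses : ReversedWithinClasses c (Before pos) (Before reversed)
  reversed-reversedWithinClasses p<q with Before-ranking⇒≺ p<q
  ... | inj₁ (cp≡cq , q<p) = (λ _ → q<p) , (λ cp≢cq → contradiction cp≡cq cp≢cq)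
  ... | inj₂ (cp≢cq , p<q) = (λ cp≡cq → contradiction cp≡cq cp≢cq) , (λ _ → p<q)

  reversed-consecutive : ClassesConsecutive c reversed
  reversed-consecutive p q r p<q q<r cp≡cr with c p Fin.≟ c q
  ... | yes cp≡cq = ≡.sym cp≡cq
  ... | no cp≢cq = consecutive p q r
    (proj₂ (reversed-reversedWithinClasses p<q) cp≢cq)
    (proj₂ (reversed-reversedWithinClasses q<r) (cp≢cq ∘ trans cp≡cr ∘ ≡.sym))
    cp≡cr

module _ {n k} {G H : Graph n} (GH : Complementary G H) {c : Fin n → Fin k}
  (hom : ClassesHomogeneous H c) (pos : Fin n ↔ Fin n)
  (consecutive : ClassesConsecutive c pos) where
  open BlockReversal c pos consecutive

  consistent-transfer : Consistent G c pos → Consistent H c reversed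
  consistent-transfer = ConsistentWith-transfer GH hom
    (Before-trans reversed) (Before-irrefl reversed) reversed-reversedWithinClasses

  reverseConsistent-transfer : ReverseConsistent G c pos → ReverseConsistent H c reversed
  reverseConsistent-transfer = ConsistentWith-transfer GH hom
    (λ q<p r<q → Before-trans reversed r<q q<p) (λ p≡q → Before-irrefl reversed (≡.sym p≡q))
    (ReversedWithinClasses-flip {_≺_ = Before pos} reversed-reversedWithinClasses)

  stronglyConsistent-transfer : StronglyConsistent G c pos → StronglyConsistent H c reversed
  stronglyConsistent-transfer (cons , rcons) =
    consistent-transfer cons , reverseConsistent-transfer rcons

module _ {n} (G : Graph n) {k : ℕ} where
  private
    GG̅ = complement-complementary G
    G̅G = Complementary-sym GG̅

  indPrec⇒cmpPrec-complement : IndPrec G k → CmpPrec (complement G) k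
  indPrec⇒cmpPrec-complement (c , pos , ind , cons , consec) =
    let cl = independent⇒cliques GG̅ ind in
    c , BlockReversal.reversed c pos consec , cl ,
    consistent-transfer GG̅ (cliques⇒homogeneous {G = complement G} cl) pos consec cons ,
    BlockReversal.reversed-consecutive c pos consec

  cmpPrec-complement⇒indPrec : CmpPrec (complement G) k → IndPrec G k
  cmpPrec-complement⇒indPrec (c , pos , cl , cons , consec) =
    let ind = cliques⇒independent GG̅ cl in
    c , BlockReversal.reversed c pos consec , ind ,
    consistent-transfer G̅G (independent⇒homogeneous {G = G} ind) pos consec cons ,
    BlockReversal.reversed-consecutive c pos consec

  pIndPrec⇒pCmpPrec-complement : PIndPrec G k → PCmpPrec (complement G) k
  pIndPrec⇒pCmpPrec-complement (c , pos , ind , cons , consec) =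
    let cl = independent⇒cliques GG̅ ind in
    c , BlockReversal.reversed c pos consec , cl ,
    stronglyConsistent-transfer GG̅ (cliques⇒homogeneous {G = complement G} cl) pos consec cons ,
    BlockReversal.reversed-consecutive c pos consec

  pCmpPrec-complement⇒pIndPrec : PCmpPrec (complement G) k → PIndPrec G k
  pCmpPrec-complement⇒pIndPrec (c , pos , cl , cons , consec) =
    let ind = cliques⇒independent GG̅ cl in
    c , BlockReversal.reversed c pos consec , ind ,
    stronglyConsistent-transfer G̅G (independent⇒homogeneous {G = G} ind) pos consec cons ,
    BlockReversal.reversed-consecutive c pos consec

IsMin-cong : {A B : ℕ → Set} → (∀ {m} → A m → B m) → (∀ {m} → B m → A m) →
  ∀ k → IsMin A k ⇔ IsMin B k
IsMin-cong A⇒B B⇒A k = mk⇔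
  (λ (a , minimal) → A⇒B a , λ m b → minimal m (B⇒A b))
  (λ (b , minimal) → B⇒A b , λ m a → minimal m (A⇒B a))

theorem29 : ∀ {n} (G : Graph n) (k : ℕ) →
    (ThinIndPrec G k ⇔ ThinCmpPrec (complement G) k) ×
    (PThinIndPrec G k ⇔ PThinCmpPrec (complement G) k)
theorem29 G k =
  IsMin-cong (indPrec⇒cmpPrec-complement G) (cmpPrec-complement⇒indPrec G) k ,
  IsMin-cong (pIndPrec⇒pCmpPrec-complement G) (pCmpPrec-complement⇒pIndPrec G) k
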